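{- Let $S_1=\{x_1,\dots,x_N\}$ and $S_2=\{y_1,\dots,y_N\}$ be sets of $d$-dimensional $0/1$ vectors. Construct the game graph $\Gamma$ with vertex set $\{s\}\cup S_1\cup C\cup S_2$ where $C=\{c_1,\dots,c_d\}$, with edges: $(s,x_i)$ for every $x_i\in S_1$; $(x_i,c_j)$ iff $x_i[j]=1$; $(c_j,y_i)$ iff $y_i[j]=1$; player-1 vertices $V_1=S_1\cup C\cup S_2$ and player-2 vertices $V_2=\{s\}$. Let the target sets be $T_i=\{y_i\}$ for $i=1,\dots,N$. Then there exist $x\in S_1$, $y\in S_2$ with $\sum_{j=1}^d x[j]y[j]=0$ if and only if player 1 has no winning policy from $s$ for the coverage objective with targets $T_1,\dots,T_N$.
   Context: In a game graph, vertices are partitioned into player-1 and player-2 vertices; player $i$ chooses successors at its vertices according to a policy (function from finite play prefixes ending in its vertex to an out-neighbour). A player-1 policy is winning from $s$ for objective $\phi$ if for every player-2 policy the resulting play lies in $\phi$. $\mathrm{Reach}(T)$ is the set of plays visiting $T$. Player 1 has a winning policy from $s$ for the coverage objective with targets $T_1,\dots,T_N$ if for every $i$ there is a player-1 policy (possibly depending on $i$) winning from $s$ for $\mathrm{Reach}(T_i)$. -}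

module Defs where

open import Data.Nat using (ℕ; zero; suc)
open import Data.Fin using (Fin)
open import Data.Bool using (Bool; true; false)
open import Data.Vec using (Vec; lookup; zipWith; sum)
open import Data.List using (List; catMaybes; map; upTo)
open import Data.Maybe using (Maybe; just; nothing)
open import Data.Product using (Σ; ∃; _×_)
open import Relation.Binary.PropositionalEquality using (_≡_)
open import Relation.Nullary using (¬_)

data Player : Set where
  P1 P2 : Player

record GameGraph : Set₁ where
  field
    V     : Set
    E     : V → V → Set
    owner : V → Player

module _ (G : GameGraph) where
  open GameGraph G

  DeadEnd : V → Set
  DeadEnd v = ∀ w → ¬ E v w

  -- A policy of player i: given the history (the vertices visited before
  -- the current one) and the current vertex v (owned by i), choose an
  -- out-neighbour of v.  At dead ends the value is irrelevant.
  record Policy (i : Player) : Set where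
    field
      choose : List V → V → V
      valid  : ∀ h v → owner v ≡ i → (∃ λ w → E v w) → E v (choose h v)
  open Policy public

  -- Plays are maximal paths, finite or infinite, encoded as
  -- ρ : ℕ → Maybe V, with ρ k = nothing meaning the play has ended
  -- (at a dead end) before step k.
  Sequence : Set
  Sequence = ℕ → Maybe V

  record IsPlay (s : V) (ρ : Sequence) : Set where
    field
      start : ρ 0 ≡ just s
      step  : ∀ k v w → ρ k ≡ just v → ρ (suc k) ≡ just w → E v w
      stop  : ∀ k v → ρ k ≡ just v → ρ (suc k) ≡ nothing → DeadEnd v
      halt  : ∀ k → ρ k ≡ nothing → ρ (suc k) ≡ nothing

  history : Sequence → ℕ → List V
  history ρ k = catMaybes (map ρ (upTo k))

  Consistent : ∀ {i} → Policy i → Sequence → Set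
  Consistent {i} σ ρ = ∀ k v w → ρ k ≡ just v → owner v ≡ i →
    ρ (suc k) ≡ just w → w ≡ choose σ (history ρ k) v

  Objective : Set₁
  Objective = Sequence → Set

  Reach : (V → Set) → Objective
  Reach T ρ = Σ ℕ λ k → Σ V λ v → ρ k ≡ just v × T v

  -- σ₁ wins from s for φ: for every player-2 policy, the resulting
  -- play (every maximal play from s consistent with both) lies in φ.
  Winning : Policy P1 → V → Objective → Set
  Winning σ₁ s φ = (σ₂ : Policy P2) (ρ : Sequence) → IsPlay s ρ →
    Consistent σ₁ ρ → Consistent σ₂ ρ → φ ρ

  CoverageWin : V → (N : ℕ) → (Fin N → V → Set) → Set
  CoverageWin s N T = (i : Fin N) → Σ (Policy P1) λ σ₁ → Winning σ₁ s (Reach (T i))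

module Construction {N d : ℕ} (x y : Fin N → Vec Bool d) where

  data Vtx : Set where
    s  : Vtx
    xv : Fin N → Vtx
    cv : Fin d → Vtx
    yv : Fin N → Vtx

  data Edge : Vtx → Vtx → Set where
    s→x : ∀ i → Edge s (xv i)
    x→c : ∀ i j → lookup (x i) j ≡ true → Edge (xv i) (cv j)
    c→y : ∀ j i → lookup (y i) j ≡ true → Edge (cv j) (yv i)

  own : Vtx → Player
  own s = P2
  own (xv _) = P1
  own (cv _) = P1
  own (yv _) = P1

  Γ : GameGraph
  Γ = record { V = Vtx ; E = Edge ; owner = own }

  targets : Fin N → Vtx → Set
  targets i v = v ≡ yv i

b2n : Bool → ℕ
b2n true = 1
b2n false = 0

mulB : Bool → Bool → ℕ
mulB a b = b2n a Data.Nat.* b2n b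
  where import Data.Nat

dot : ∀ {d} → Vec Bool d → Vec Bool d → ℕ
dot u v = sum (zipWith mulB u v)

module Submission where

-- If x_i and y_k are orthogonal, player 2 moves to x_i; every path from x_i to y_k passes
-- through some c_j with x_i[j] = y_k[j] = 1, so no player-1 policy reaches y_k on the
-- (unique) resulting play.  Conversely, if y_k meets every x_i, the positional policy
-- x_i ↦ c_j (for such a j), c_j ↦ y_k forces a visit to y_k at step 3 whatever player 2 does.
-- Decidability of orthogonality turns the contrapositive into the stated equivalence.

open import Defs
open import Data.Nat using (ℕ; zero; suc; _+_)
open import Data.Nat.Properties using (+-comm; m+n≡0⇒n≡0) renaming (_≟_ to _≟ℕ_)
open import Data.Fin using (Fin; zero; suc)
open import Data.Fin.Properties using (any?)
open import Data.Bool using (Bool; true; false; if_then_else_)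
open import Data.Bool.Properties using () renaming (_≟_ to _≟ᵇ_)
open import Data.Vec using (Vec; []; _∷_; lookup)
open import Data.List using (List; []; _∷_; _++_; _∷ʳ_; catMaybes; map; upTo)
open import Data.List.Properties using (upTo-∷ʳ; map-++; catMaybes-++)
open import Data.Maybe using (Maybe; just; nothing; _>>=_)
open import Data.Maybe.Properties using (just-injective)
open import Data.Product using (Σ; ∃; _×_; _,_; proj₁; proj₂)
open import Data.Sum using (_⊎_; inj₁; inj₂)
open import Data.Unit using (⊤; tt)
open import Data.Empty using (⊥-elim)
open import Function using (_∘_)
open import Relation.Nullary using (¬_; yes; no)
open import Relation.Unary using (Decidable)
open import Relation.Binary.PropositionalEquality
  using (_≡_; _≢_; refl; sym; trans; cong; subst; module ≡-Reasoning)
open import Function.Bundles using (_⇔_; mk⇔)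

Overlap : ∀ {d} → Vec Bool d → Vec Bool d → Set
Overlap u v = ∃ λ j → lookup u j ≡ true × lookup v j ≡ true

overlap⇒dot≢0 : ∀ {d} (u v : Vec Bool d) → Overlap u v → dot u v ≢ 0
overlap⇒dot≢0 (_ ∷ _) (_ ∷ _) (zero , refl , refl) ()
overlap⇒dot≢0 (a ∷ u) (b ∷ v) (suc j , p , q) =
  overlap⇒dot≢0 u v (j , p , q) ∘ m+n≡0⇒n≡0 (mulB a b)

dot≢0⇒overlap : ∀ {d} (u v : Vec Bool d) → dot u v ≢ 0 → Overlap u v
dot≢0⇒overlap [] [] dot≢0 = ⊥-elim (dot≢0 refl)
dot≢0⇒overlap (true ∷ u) (true ∷ v) dot≢0 = zero , refl , refl
dot≢0⇒overlap (true ∷ u) (false ∷ v) dot≢0 with dot≢0⇒overlap u v dot≢0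
... | j , p , q = suc j , p , q
dot≢0⇒overlap (false ∷ u) (b ∷ v) dot≢0 with dot≢0⇒overlap u v dot≢0
... | j , p , q = suc j , p , q

module _ (G : GameGraph) where
  open GameGraph G

  MovesDecidable : Set
  MovesDecidable = ∀ v → DeadEnd G v ⊎ ∃ (E v)

  moves-by-search : ∀ {n v} {P : Fin n → Set} → Decidable P →
    (∀ a → P a → ∃ (E v)) → (∀ {w} → E v w → ∃ P) → DeadEnd G v ⊎ ∃ (E v)
  moves-by-search P? found exhaustive with any? P?
  ... | yes (a , p) = inj₂ (found a p)
  ... | no none = inj₁ λ _ e → none (exhaustive e)

  successor : MovesDecidable → V → V
  successor moves? v with moves? v
  ... | inj₁ _ = v
  ... | inj₂ (w , _) = w

  successor-edge : ∀ moves? v → ∃ (E v) → E v (successor moves? v)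
  successor-edge moves? v e with moves? v
  ... | inj₁ dead = ⊥-elim (dead _ (proj₂ e))
  ... | inj₂ (_ , e′) = e′

  data Walk : ℕ → V → V → Set where
    []  : ∀ {u} → Walk 0 u u
    _▷_ : ∀ {n u v w} → Walk n u v → E v w → Walk (suc n) u w

  infixl 5 _▷_

  module _ {s : V} {ρ : Sequence G} (play : IsPlay G s ρ) where
    open IsPlay play

    continues : ∀ k {v} → ρ k ≡ just v → ∃ (E v) → ∃ λ w → ρ (suc k) ≡ just w × E v w
    continues k {v} ρk (w , e) with ρ (suc k) in ρk+1
    ... | just w′ = w′ , refl , step k v w′ ρk ρk+1
    ... | nothing = ⊥-elim (stop k v ρk ρk+1 w e)

    follows : ∀ {i} (σ : Policy G i) → Consistent G σ ρ →
      ∀ k {v} → ρ k ≡ just v → owner v ≡ i → ∃ (E v) →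
      ρ (suc k) ≡ just (choose σ (history G ρ k) v)
    follows σ consistent k ρk own e with continues k ρk e
    ... | w , ρk+1 , _ = trans ρk+1 (cong just (consistent k _ w ρk own ρk+1))

    walk-between : ∀ k n {u v} → ρ k ≡ just u → ρ (n + k) ≡ just v → Walk n u v
    walk-between k zero ρk ρk′ = subst (Walk 0 _) (just-injective (trans (sym ρk) ρk′)) []
    walk-between k (suc n) {v = v} ρk ρ1+n+k with ρ (n + k) in ρn+k
    ... | just w = walk-between k n ρk ρn+k ▷ step (n + k) w v ρn+k ρ1+n+k
    ... | nothing with () ← trans (sym (halt (n + k) ρn+k)) ρ1+n+k

module Outcome (G : GameGraph) (moves? : MovesDecidable G) (s : GameGraph.V G)
               (σ₁ : Policy G P1) (σ₂ : Policy G P2) where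
  open GameGraph G

  policy : (i : Player) → Policy G i
  policy P1 = σ₁
  policy P2 = σ₂

  move : List V → V → Maybe V
  move h v with moves? v
  ... | inj₁ _ = nothing
  ... | inj₂ _ = just (choose (policy (owner v)) h v)

  move-edge : ∀ h v {w} → move h v ≡ just w → E v w
  move-edge h v eq with moves? v | eq
  ... | inj₂ e | refl = valid (policy (owner v)) h v refl e

  move-choice : ∀ h v {w} → move h v ≡ just w → w ≡ choose (policy (owner v)) h v
  move-choice h v eq with moves? v | eq
  ... | inj₂ _ | refl = refl

  move-dead : ∀ h v → move h v ≡ nothing → DeadEnd G v
  move-dead h v eq with moves? v | eq
  ... | inj₁ dead | _ = dead

  -- visited k is history G outcome k, built alongside the play so that the recursion is structural.
  visited : ℕ → List V
  outcome : Sequence G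
  visited zero = []
  visited (suc k) = visited k ++ catMaybes (outcome k ∷ [])
  outcome zero = just s
  outcome (suc k) = outcome k >>= move (visited k)

  visited≡history : ∀ k → visited k ≡ history G outcome k
  visited≡history zero = refl
  visited≡history (suc k) = begin
    visited k ++ catMaybes (outcome k ∷ [])
      ≡⟨ cong (_++ catMaybes (outcome k ∷ [])) (visited≡history k) ⟩
    catMaybes (map outcome (upTo k)) ++ catMaybes (outcome k ∷ [])
      ≡⟨ catMaybes-++ (map outcome (upTo k)) (outcome k ∷ []) ⟨
    catMaybes (map outcome (upTo k) ++ outcome k ∷ [])
      ≡⟨ cong catMaybes (map-++ outcome (upTo k) (k ∷ [])) ⟨
    catMaybes (map outcome (upTo k ∷ʳ k))
      ≡⟨ cong (catMaybes ∘ map outcome) (upTo-∷ʳ k) ⟩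
    history G outcome (suc k) ∎
    where open ≡-Reasoning

  outcome-suc : ∀ k {v} → outcome k ≡ just v → outcome (suc k) ≡ move (visited k) v
  outcome-suc k ρk = cong (_>>= move (visited k)) ρk

  outcome-isPlay : IsPlay G s outcome
  outcome-isPlay = record
    { start = refl
    ; step  = λ k v w ρk ρk+1 → move-edge (visited k) v (trans (sym (outcome-suc k ρk)) ρk+1)
    ; stop  = λ k v ρk ρk+1 → move-dead (visited k) v (trans (sym (outcome-suc k ρk)) ρk+1)
    ; halt  = λ k ρk → cong (_>>= move (visited k)) ρk
    }

  outcome-consistent : (i : Player) → Consistent G (policy i) outcome
  outcome-consistent _ k v w ρk refl ρk+1 =
    trans (move-choice (visited k) v (trans (sym (outcome-suc k ρk)) ρk+1))
          (cong (λ h → choose (policy (owner v)) h v) (visited≡history k))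

module _ {N d : ℕ} (x y : Fin N → Vec Bool d) where
  open Construction x y

  moves? : MovesDecidable Γ
  moves? s = moves-by-search Γ {P = λ _ → ⊤} (λ _ → yes tt)
    (λ i _ → xv i , s→x i) λ { (s→x i) → i , tt }
  moves? (xv i) = moves-by-search Γ (λ j → lookup (x i) j ≟ᵇ true)
    (λ j p → cv j , x→c i j p) λ { (x→c _ j p) → j , p }
  moves? (cv j) = moves-by-search Γ (λ m → lookup (y m) j ≟ᵇ true)
    (λ m q → yv m , c→y j m q) λ { (c→y _ m q) → m , q }
  moves? (yv m) = inj₁ λ _ ()

  walk-x-to-y : ∀ {n i m} → Walk Γ n (xv i) (yv m) → Overlap (x i) (y m)
  walk-x-to-y ([] ▷ x→c _ j p ▷ c→y _ _ q) = j , p , q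
  walk-x-to-y (_ ▷ () ▷ s→x _ ▷ x→c _ _ _ ▷ c→y _ _ _)

  enter : Fin N → Policy Γ P2
  enter i = record { choose = λ _ _ → xv i ; valid = valid-enter }
    where
    valid-enter : ∀ (h : List Vtx) v → own v ≡ P2 → ∃ (Edge v) → Edge v (xv i)
    valid-enter _ s _ _ = s→x i

  entered-reach⇒overlap : ∀ {i k ρ} → IsPlay Γ s ρ → Consistent Γ (enter i) ρ →
    Reach Γ (targets k) ρ → Overlap (x i) (y k)
  entered-reach⇒overlap {i} {k} {ρ} play consistent reach
    with continues Γ play 0 (IsPlay.start play) (xv i , s→x i)
  ... | w , ρ₁ , _ with consistent 0 s w (IsPlay.start play) refl ρ₁ | reach
  ...   | refl | zero , _ , ρ₀ , refl with () ← trans (sym (IsPlay.start play)) ρ₀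
  ...   | refl | suc n , _ , ρ₁₊ₙ , refl =
    walk-x-to-y (walk-between Γ play 1 n ρ₁ (subst (λ p → ρ p ≡ just (yv k)) (+-comm 1 n) ρ₁₊ₙ))

  disjoint⇒¬coverage : ∀ i k → dot (x i) (y k) ≡ 0 → ¬ CoverageWin Γ s N targets
  disjoint⇒¬coverage i k x⊥y cover = overlap⇒dot≢0 (x i) (y k) common-one x⊥y
    where
    open Outcome Γ moves? s (proj₁ (cover k)) (enter i)
    reaches : Reach Γ (targets k) outcome
    reaches = proj₂ (cover k) (enter i) outcome outcome-isPlay
      (outcome-consistent P1) (outcome-consistent P2)
    common-one : Overlap (x i) (y k)
    common-one = entered-reach⇒overlap outcome-isPlay (outcome-consistent P2) reaches

  module _ (k : Fin N) (covered : ∀ i → Overlap (x i) (y k)) where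
    toward : Vtx → Vtx
    toward s = s
    toward (xv i) = cv (proj₁ (covered i))
    toward (cv j) = if lookup (y k) j then yv k else successor Γ moves? (cv j)
    toward (yv m) = yv m

    toward-hit : ∀ {j} → lookup (y k) j ≡ true → toward (cv j) ≡ yv k
    toward-hit hit rewrite hit = refl

    toward-valid : ∀ (h : List Vtx) v → own v ≡ P1 → ∃ (Edge v) → Edge v (toward v)
    toward-valid _ (xv i) _ _ = x→c i _ (proj₁ (proj₂ (covered i)))
    toward-valid _ (cv j) _ e with lookup (y k) j in hit
    ... | true = c→y j k hit
    ... | false = successor-edge Γ moves? (cv j) e
    toward-valid _ (yv m) _ (_ , ())

    toward-policy : Policy Γ P1
    toward-policy = record { choose = λ _ → toward ; valid = toward-valid }

    toward-wins : Winning Γ toward-policy s (Reach Γ (targets k))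
    toward-wins _ ρ play consistent _ with continues Γ play 0 (IsPlay.start play) (xv k , s→x k)
    ... | _ , ρ₁ , s→x i = 3 , yv k , ρ₃ , refl
      where
      j = proj₁ (covered i)
      xᵢ[j] = proj₁ (proj₂ (covered i))
      yₖ[j] = proj₂ (proj₂ (covered i))
      ρ₂ : ρ 2 ≡ just (cv j)
      ρ₂ = follows Γ play toward-policy consistent 1 ρ₁ refl (cv j , x→c i j xᵢ[j])
      ρ₃ : ρ 3 ≡ just (yv k)
      ρ₃ = trans (follows Γ play toward-policy consistent 2 ρ₂ refl (yv k , c→y j k yₖ[j]))
                 (cong just (toward-hit yₖ[j]))

  overlapping⇒coverage : (∀ k i → Overlap (x i) (y k)) → CoverageWin Γ s N targets
  overlapping⇒coverage covered k = toward-policy k (covered k) , toward-wins k (covered k)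

  ¬coverage⇒disjoint : ¬ CoverageWin Γ s N targets → Σ (Fin N) λ i → Σ (Fin N) λ k → dot (x i) (y k) ≡ 0
  ¬coverage⇒disjoint lost with any? (λ i → any? (λ k → dot (x i) (y k) ≟ℕ 0))
  ... | yes disjoint = disjoint
  ... | no none = ⊥-elim (lost (overlapping⇒coverage λ k i →
    dot≢0⇒overlap (x i) (y k) λ x⊥y → none (i , k , x⊥y)))

mainTheorem11 : (N d : ℕ) (x y : Fin N → Vec Bool d) →
    (Σ (Fin N) λ i → Σ (Fin N) λ k → dot (x i) (y k) ≡ 0)
      ⇔ (¬ CoverageWin (Construction.Γ x y) Construction.s N (Construction.targets x y))
mainTheorem11 N d x y =
  mk⇔ (λ (i , k , x⊥y) → disjoint⇒¬coverage x y i k x⊥y) (¬coverage⇒disjoint x y)
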